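{- For all FEL-terms $P, Q \in \mathrm{FT}$: $\mathrm{fe}(P) = \mathrm{fe}(Q)$ (i.e. $\mathrm{FFEL} \vDash P = Q$) if and only if $\mathrm{CP}_f \vdash P = Q$.
   Context: Let $A$ be a countable set of atoms. $\mathrm{FT}$ is generated by $P ::= a \ (a \in A) \mid \mathsf{T} \mid \mathsf{F} \mid \neg P \mid (P \wedge^{\bullet} P) \mid (P \vee^{\bullet} P)$ (full left-sequential connectives). Let $\mathcal{T}$ be the set of finite binary trees: $\mathsf{T}, \mathsf{F} \in \mathcal{T}$ and $(X \trianglelefteq a \trianglerighteq Y) \in \mathcal{T}$ for $X, Y \in \mathcal{T}$, $a \in A$. Leaf replacement: $\mathsf{T}[\mathsf{T}\mapsto Y, \mathsf{F}\mapsto Z] = Y$, $\mathsf{F}[\mathsf{T}\mapsto Y, \mathsf{F}\mapsto Z] = Z$, $(X' \trianglelefteq a \trianglerighteq X'')[\mathsf{T}\mapsto Y, \mathsf{F}\mapsto Z] = X'[\ldots] \trianglelefteq a \trianglerighteq X''[\ldots]$; unmentioned leaves unchanged. $\mathrm{fe}: \mathrm{FT} \to \mathcal{T}$: $\mathrm{fe}(\mathsf{T}) = \mathsf{T}$, $\mathrm{fe}(\mathsf{F}) = \mathsf{F}$, $\mathrm{fe}(a) = \mathsf{T} \trianglelefteq a \trianglerighteq \mathsf{F}$, $\mathrm{fe}(\neg P) = \mathrm{fe}(P)[\mathsf{T}\mapsto\mathsf{F}, \mathsf{F}\mapsto\mathsf{T}]$, $\mathrm{fe}(P \wedge^{\bullet}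 Q) = \mathrm{fe}(P)[\mathsf{T}\mapsto \mathrm{fe}(Q), \mathsf{F}\mapsto \mathrm{fe}(Q)[\mathsf{T}\mapsto\mathsf{F}]]$, $\mathrm{fe}(P \vee^{\bullet} Q) = \mathrm{fe}(P)[\mathsf{T}\mapsto \mathrm{fe}(Q)[\mathsf{F}\mapsto\mathsf{T}], \mathsf{F}\mapsto \mathrm{fe}(Q)]$; $\mathrm{FFEL}\vDash P=Q$ iff $\mathrm{fe}(P)=\mathrm{fe}(Q)$. Terms $\mathrm{CT}_f$ are generated by $P ::= a \mid \mathsf{T} \mid \mathsf{F} \mid P \triangleleft P \triangleright P \mid \neg P \mid P \wedge^{\bullet} P \mid P \vee^{\bullet} P$, where $y \triangleleft x \triangleright z$ is the conditional "if $x$ then $y$ else $z$". $\mathrm{CP}_f$ consists of $x \triangleleft \mathsf{T} \triangleright y = x$; $x \triangleleft \mathsf{F} \triangleright y = y$; $\mathsf{T} \triangleleft x \triangleright \mathsf{F} = x$; $x \triangleleft (y \triangleleft z \triangleright u) \triangleright v = (x \triangleleft y \triangleright v) \triangleleft z \triangleright (x \triangleleft u \triangleright v)$; together with $\neg x = \mathsf{F} \triangleleft x \triangleright \mathsf{T}$, $x \wedge^{\bullet} y = y \triangleleft x \triangleright (\mathsf{F} \triangleleft y \triangleright \mathsf{F})$, $x \vee^{\bullet} y = (\mathsf{T} \triangleleft y \triangleright \mathsf{T}) \triangleleft x \triangleright y$. $\mathrm{CP}_f \vdash s = t$ denotes derivability by equational logic from $\mathrm{CP}_f$. -}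

module Defs where

open import Data.Nat using (ℕ)

Atom : Set
Atom = ℕ

data FT : Set where
  atm  : Atom → FT
  tt   : FT
  ff   : FT
  ¬ᶠ_  : FT → FT
  _∧ᶠ_ : FT → FT → FT
  _∨ᶠ_ : FT → FT → FT

data Tree : Set where
  T : Tree
  F : Tree
  node : Tree → Atom → Tree → Tree   -- node X a Y  =  X ⊴ a ⊵ Y

_[T↦_,F↦_] : Tree → Tree → Tree → Tree
T [T↦ Y ,F↦ Z ] = Y
F [T↦ Y ,F↦ Z ] = Z
node X' a X'' [T↦ Y ,F↦ Z ] = node (X' [T↦ Y ,F↦ Z ]) a (X'' [T↦ Y ,F↦ Z ])

_[T↦_] : Tree → Tree → Tree
X [T↦ Y ] = X [T↦ Y ,F↦ F ]

_[F↦_] : Tree → Tree → Tree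
X [F↦ Z ] = X [T↦ T ,F↦ Z ]

fe : FT → Tree
fe (atm a) = node T a F
fe tt = T
fe ff = F
fe (¬ᶠ P) = fe P [T↦ F ,F↦ T ]
fe (P ∧ᶠ Q) = fe P [T↦ fe Q ,F↦ fe Q [T↦ F ] ]
fe (P ∨ᶠ Q) = fe P [T↦ fe Q [F↦ T ] ,F↦ fe Q ]

-- Terms CT_f (over variables, so that axioms may be stated with variables)
data CT (V : Set) : Set where
  var  : V → CT V
  atm  : Atom → CT V
  tt   : CT V
  ff   : CT V
  cond : CT V → CT V → CT V → CT V   -- cond y x z  =  y ◁ x ▷ z
  ¬ᶜ_  : CT V → CT V
  _∧ᶜ_ : CT V → CT V → CT V
  _∨ᶜ_ : CT V → CT V → CT V

-- Equational logic over CP_f. Axioms are stated as schemas over arbitrary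
-- terms, which is the closure of the axioms under substitution.
infix 4 _⊢_≈_
data _⊢_≈_ (V : Set) : CT V → CT V → Set where
  refl≈  : ∀ {s} → V ⊢ s ≈ s
  sym≈   : ∀ {s t} → V ⊢ s ≈ t → V ⊢ t ≈ s
  trans≈ : ∀ {s t u} → V ⊢ s ≈ t → V ⊢ t ≈ u → V ⊢ s ≈ u
  cong-cond : ∀ {s s' t t' u u'} → V ⊢ s ≈ s' → V ⊢ t ≈ t' → V ⊢ u ≈ u' →
              V ⊢ cond s t u ≈ cond s' t' u'
  cong-¬ : ∀ {s s'} → V ⊢ s ≈ s' → V ⊢ ¬ᶜ s ≈ ¬ᶜ s'
  cong-∧ : ∀ {s s' t t'} → V ⊢ s ≈ s' → V ⊢ t ≈ t' → V ⊢ s ∧ᶜ t ≈ s' ∧ᶜ t'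
  cong-∨ : ∀ {s s' t t'} → V ⊢ s ≈ s' → V ⊢ t ≈ t' → V ⊢ s ∨ᶜ t ≈ s' ∨ᶜ t'
  cp1 : ∀ x y → V ⊢ cond x tt y ≈ x
  cp2 : ∀ x y → V ⊢ cond x ff y ≈ y
  cp3 : ∀ x → V ⊢ cond tt x ff ≈ x
  cp4 : ∀ x y z u v →
        V ⊢ cond x (cond y z u) v ≈ cond (cond x y v) z (cond x u v)
  ax-¬ : ∀ x → V ⊢ ¬ᶜ x ≈ cond ff x tt
  ax-∧ : ∀ x y → V ⊢ x ∧ᶜ y ≈ cond y x (cond ff y ff)
  ax-∨ : ∀ x y → V ⊢ x ∨ᶜ y ≈ cond (cond tt y tt) x y

⌜_⌝ : ∀ {V : Set} → FT → CT V
⌜ atm a ⌝ = atm a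
⌜ tt ⌝ = tt
⌜ ff ⌝ = ff
⌜ ¬ᶠ P ⌝ = ¬ᶜ ⌜ P ⌝
⌜ P ∧ᶠ Q ⌝ = ⌜ P ⌝ ∧ᶜ ⌜ Q ⌝
⌜ P ∨ᶠ Q ⌝ = ⌜ P ⌝ ∨ᶜ ⌜ Q ⌝

module Submission where

-- CT_f-terms are interpreted as evaluation trees (variables via a
-- valuation): an atom is the one-node tree T ⊴ a ⊵ F and a conditional
-- y ◁ x ▷ z is the leaf replacement ⟦x⟧[T ↦ ⟦y⟧, F ↦ ⟦z⟧]; the connectives
-- are interpreted through their defining CP_f-axioms, so those axioms hold by
-- computation.  The remaining axioms are the two monad laws of leaf
-- replacement (T ◁ x ▷ F = x is the unit law, the distribution axiom is
-- associativity), so derivable equations have equal interpretations.  On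
-- FEL-terms the interpretation agrees with fe.
--
-- Every tree X is read back as a nested conditional tr X.  By
-- induction on the tree, a conditional of read-backs is provably the
-- read-back of the leaf replacement; hence every closed term t is provably
-- equal to its normal form tr ⟦t⟧.  Closed terms with the same
-- interpretation share a normal form and are therefore provably equal.

open import Defs
open import Data.Empty using (⊥; ⊥-elim)
open import Data.Product using (_×_; _,_)
open import Relation.Binary.PropositionalEquality using (_≡_; refl; sym; trans; cong₂; module ≡-Reasoning)

replace-id : ∀ X → X [T↦ T ,F↦ F ] ≡ X
replace-id T = refl
replace-id F = refl
replace-id (node X a Y) = cong₂ (λ L R → node L a R) (replace-id X) (replace-id Y)

replace-assoc : ∀ Z Y U X V →
  Z [T↦ Y ,F↦ U ] [T↦ X ,F↦ V ] ≡ Z [T↦ Y [T↦ X ,F↦ V ] ,F↦ U [T↦ X ,F↦ V ] ]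
replace-assoc T Y U X V = refl
replace-assoc F Y U X V = refl
replace-assoc (node Z a Z') Y U X V =
  cong₂ (λ L R → node L a R) (replace-assoc Z Y U X V) (replace-assoc Z' Y U X V)

⟦_⟧⟨_⟩ : ∀ {V : Set} → CT V → (V → Tree) → Tree
⟦ var x ⟧⟨ ρ ⟩ = ρ x
⟦ atm a ⟧⟨ ρ ⟩ = node T a F
⟦ tt ⟧⟨ ρ ⟩ = T
⟦ ff ⟧⟨ ρ ⟩ = F
⟦ cond y x z ⟧⟨ ρ ⟩ = ⟦ x ⟧⟨ ρ ⟩ [T↦ ⟦ y ⟧⟨ ρ ⟩ ,F↦ ⟦ z ⟧⟨ ρ ⟩ ]
⟦ ¬ᶜ x ⟧⟨ ρ ⟩ = ⟦ x ⟧⟨ ρ ⟩ [T↦ F ,F↦ T ]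
⟦ x ∧ᶜ y ⟧⟨ ρ ⟩ = ⟦ x ⟧⟨ ρ ⟩ [T↦ ⟦ y ⟧⟨ ρ ⟩ ,F↦ ⟦ y ⟧⟨ ρ ⟩ [T↦ F ,F↦ F ] ]
⟦ x ∨ᶜ y ⟧⟨ ρ ⟩ = ⟦ x ⟧⟨ ρ ⟩ [T↦ ⟦ y ⟧⟨ ρ ⟩ [T↦ T ,F↦ T ] ,F↦ ⟦ y ⟧⟨ ρ ⟩ ]

⟦_⟧ : CT ⊥ → Tree
⟦ t ⟧ = ⟦ t ⟧⟨ ⊥-elim ⟩

sound : ∀ {V} {s t : CT V} → V ⊢ s ≈ t → ∀ ρ → ⟦ s ⟧⟨ ρ ⟩ ≡ ⟦ t ⟧⟨ ρ ⟩
sound refl≈ ρ = refl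
sound (sym≈ d) ρ = sym (sound d ρ)
sound (trans≈ d e) ρ = trans (sound d ρ) (sound e ρ)
sound (cong-cond d e f) ρ rewrite sound d ρ | sound e ρ | sound f ρ = refl
sound (cong-¬ d) ρ rewrite sound d ρ = refl
sound (cong-∧ d e) ρ rewrite sound d ρ | sound e ρ = refl
sound (cong-∨ d e) ρ rewrite sound d ρ | sound e ρ = refl
sound (cp1 x y) ρ = refl
sound (cp2 x y) ρ = refl
sound (cp3 x) ρ = replace-id ⟦ x ⟧⟨ ρ ⟩
sound (cp4 x y z u v) ρ =
  replace-assoc ⟦ z ⟧⟨ ρ ⟩ ⟦ y ⟧⟨ ρ ⟩ ⟦ u ⟧⟨ ρ ⟩ ⟦ x ⟧⟨ ρ ⟩ ⟦ v ⟧⟨ ρ ⟩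
sound (ax-¬ x) ρ = refl
sound (ax-∧ x y) ρ = refl
sound (ax-∨ x y) ρ = refl

⟦⌜⌝⟧≡fe : ∀ P → ⟦ ⌜ P ⌝ ⟧ ≡ fe P
⟦⌜⌝⟧≡fe (atm a) = refl
⟦⌜⌝⟧≡fe tt = refl
⟦⌜⌝⟧≡fe ff = refl
⟦⌜⌝⟧≡fe (¬ᶠ P) rewrite ⟦⌜⌝⟧≡fe P = refl
⟦⌜⌝⟧≡fe (P ∧ᶠ Q) rewrite ⟦⌜⌝⟧≡fe P | ⟦⌜⌝⟧≡fe Q = refl
⟦⌜⌝⟧≡fe (P ∨ᶠ Q) rewrite ⟦⌜⌝⟧≡fe P | ⟦⌜⌝⟧≡fe Q = refl

tr : ∀ {V} → Tree → CT V
tr T = tt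
tr F = ff
tr (node X a Y) = cond (tr X) (atm a) (tr Y)

tr-cong : ∀ {V} {X Y : Tree} → X ≡ Y → V ⊢ tr X ≈ tr Y
tr-cong refl = refl≈

-- Leaf replacement is provably a conditional: Y ◁ X ▷ Z equals the
-- read-back of X[T ↦ Y, F ↦ Z] (push the conditional down by the
-- distribution axiom and resolve it at the leaves by cp1/cp2).
cond-tr : ∀ {V} X Y Z → V ⊢ cond (tr Y) (tr X) (tr Z) ≈ tr (X [T↦ Y ,F↦ Z ])
cond-tr T Y Z = cp1 _ _
cond-tr F Y Z = cp2 _ _
cond-tr (node X a X') Y Z =
  trans≈ (cp4 _ _ _ _ _) (cong-cond (cond-tr X Y Z) refl≈ (cond-tr X' Y Z))

cond-normal : ∀ {V} {y x z : CT V} {Y X Z} →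
  V ⊢ y ≈ tr Y → V ⊢ x ≈ tr X → V ⊢ z ≈ tr Z →
  V ⊢ cond y x z ≈ tr (X [T↦ Y ,F↦ Z ])
cond-normal {X = X} y≈Y x≈X z≈Z = trans≈ (cong-cond y≈Y x≈X z≈Z) (cond-tr X _ _)

normalise : ∀ t → ⊥ ⊢ t ≈ tr ⟦ t ⟧
normalise (atm a) = sym≈ (cp3 _)
normalise tt = refl≈
normalise ff = refl≈
normalise (cond y x z) = cond-normal (normalise y) (normalise x) (normalise z)
normalise (¬ᶜ x) = trans≈ (ax-¬ x) (cond-normal refl≈ (normalise x) refl≈)
normalise (x ∧ᶜ y) =
  trans≈ (ax-∧ x y)
    (cond-normal (normalise y) (normalise x) (cond-normal refl≈ (normalise y) refl≈))
normalise (x ∨ᶜ y) =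
  trans≈ (ax-∨ x y)
    (cond-normal (cond-normal refl≈ (normalise y) refl≈) (normalise x) (normalise y))

complete : ∀ {s t} → ⟦ s ⟧ ≡ ⟦ t ⟧ → ⊥ ⊢ s ≈ t
complete {s} {t} eq = trans≈ (normalise s) (trans≈ (tr-cong eq) (sym≈ (normalise t)))

mainTheorem6 : (P Q : FT) →
    ((fe P ≡ fe Q → ⊥ ⊢ ⌜ P ⌝ ≈ ⌜ Q ⌝) × (⊥ ⊢ ⌜ P ⌝ ≈ ⌜ Q ⌝ → fe P ≡ fe Q))
mainTheorem6 P Q = fe-complete , fe-sound
  where
  open ≡-Reasoning

  fe-complete : fe P ≡ fe Q → ⊥ ⊢ ⌜ P ⌝ ≈ ⌜ Q ⌝
  fe-complete eq = complete (begin
    ⟦ ⌜ P ⌝ ⟧ ≡⟨ ⟦⌜⌝⟧≡fe P ⟩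
    fe P      ≡⟨ eq ⟩
    fe Q      ≡⟨ sym (⟦⌜⌝⟧≡fe Q) ⟩
    ⟦ ⌜ Q ⌝ ⟧ ∎)

  fe-sound : ⊥ ⊢ ⌜ P ⌝ ≈ ⌜ Q ⌝ → fe P ≡ fe Q
  fe-sound d = begin
    fe P      ≡⟨ sym (⟦⌜⌝⟧≡fe P) ⟩
    ⟦ ⌜ P ⌝ ⟧ ≡⟨ sound d ⊥-elim ⟩
    ⟦ ⌜ Q ⌝ ⟧ ≡⟨ ⟦⌜⌝⟧≡fe Q ⟩
    fe Q      ∎
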